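{- For $n\ge 1$ let $a_n = |S_n^2(213,231,321)|$. Then $a_1=1$ and $a_{n+1} = 2(n+1)$ for all $n\ge 1$.
   Context: A $3$-permutation of size $n$ is an ordered pair $(\sigma,\sigma')$ of permutations of $[n]=\{1,\dots,n\}$. A (classical) permutation $\tau\in S_n$ contains a pattern $\pi\in S_k$ if there are indices $c_1<\dots<c_k$ such that $\tau(c_1)\cdots\tau(c_k)$ is order-isomorphic to $\pi$, and avoids $\pi$ otherwise. A $3$-permutation $(\sigma,\sigma')$ avoids a pattern $\pi\in S_k$ if each of the three permutations $\sigma$, $\sigma'$, and $\sigma'\circ\sigma^{ -1}$ (where $(\sigma'\circ\sigma^{ -1})(i)=\sigma'(\sigma^{ -1}(i))$) avoids $\pi$. $S_n^2(\pi_1,\dots,\pi_m)$ denotes the set of $3$-permutations of size $n$ avoiding each of $\pi_1,\dots,\pi_m$. Patterns are written in one-line notation. -}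

module Defs where

open import Data.Nat using (ℕ; zero; suc; _<ᵇ_)
open import Data.Bool using (Bool; true; false; _∧_; _∨_; not)
open import Data.Fin using (Fin; toℕ; _≟_)
open import Data.Vec using (Vec; []; _∷_; lookup; tabulate; toList)
open import Data.List using (List; []; _∷_; _++_; map; concatMap; filter; length; allFin)
open import Data.Bool.ListAction using (all; any)
open import Data.Product using (_×_; _,_)
open import Relation.Nullary.Decidable using (⌊_⌋)

-- A permutation of [n] in one-line notation: the vector (σ(1), …, σ(n)),
-- with [n] represented by Fin n (values 0 … n-1).

allVecs : (m n : ℕ) → List (Vec (Fin m) n)
allVecs m zero    = [] ∷ []
allVecs m (suc n) = concatMap (λ x → map (x ∷_) (allVecs m n)) (allFin m)

-- A vector of length n over Fin n is a permutation iff it is injective.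
injective? : ∀ {n} → Vec (Fin n) n → Bool
injective? {n} v =
  all (λ i → all (λ j → ⌊ i ≟ j ⌋ ∨ not ⌊ lookup v i ≟ lookup v j ⌋) (allFin n)) (allFin n)

perms : (n : ℕ) → List (Vec (Fin n) n)
perms n = filter (λ v → Data.Bool._≟_ (injective? v) true) (allVecs n n)

-- Inverse of a permutation: σ⁻¹(i) is the (unique) j with σ(j) = i.
-- (The fallback value is never used when σ is a permutation.)
inverse : ∀ {n} → Vec (Fin n) n → Vec (Fin n) n
inverse {zero}  σ = []
inverse {suc n} σ = tabulate (λ i → search i (allFin (suc n)))
  where
  search : Fin (suc n) → List (Fin (suc n)) → Fin (suc n)
  search i []       = Fin.zero
  search i (j ∷ js) with ⌊ lookup σ j ≟ i ⌋
  ... | true  = j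
  ... | false = search i js

-- Composition in the paper's convention: (σ' ∘ σ)(i) = σ'(σ(i)).
compose : ∀ {n} → Vec (Fin n) n → Vec (Fin n) n → Vec (Fin n) n
compose σ' σ = tabulate (λ i → lookup σ' (lookup σ i))

subseqs : ∀ {A : Set} (k : ℕ) → List A → List (Vec A k)
subseqs zero    xs       = [] ∷ []
subseqs (suc k) []       = []
subseqs (suc k) (x ∷ xs) = map (x ∷_) (subseqs k xs) ++ subseqs (suc k) xs

orderIso : ∀ {n k} → Vec (Fin k) k → Vec (Fin n) k → Bool
orderIso {n} {k} π w =
  all (λ a → all (λ b →
    eqB (toℕ (lookup w a) <ᵇ toℕ (lookup w b)) (toℕ (lookup π a) <ᵇ toℕ (lookup π b)))
    (allFin k)) (allFin k)
  where
  eqB : Bool → Bool → Bool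
  eqB true  y = y
  eqB false y = not y

contains : ∀ {n k} → Vec (Fin k) k → Vec (Fin n) n → Bool
contains {n} {k} π τ = any (orderIso π) (subseqs k (toList τ))

avoids : ∀ {n k} → Vec (Fin k) k → Vec (Fin n) n → Bool
avoids π τ = not (contains π τ)

record Pattern : Set where
  constructor pat
  field
    size : ℕ
    word : Vec (Fin size) size

avoids3 : ∀ {n} → Pattern → Vec (Fin n) n × Vec (Fin n) n → Bool
avoids3 (pat k π) (σ , σ') = avoids π σ ∧ avoids π σ' ∧ avoids π (compose σ' (inverse σ))

avoidsAll : ∀ {n} → List Pattern → Vec (Fin n) n × Vec (Fin n) n → Bool
avoidsAll ps s = all (λ p → avoids3 p s) ps

S2 : (n : ℕ) → List Pattern → List (Vec (Fin n) n × Vec (Fin n) n)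
S2 n ps = filter (λ s → Data.Bool._≟_ (avoidsAll ps s) true)
  (concatMap (λ σ → map (σ ,_) (perms n)) (perms n))

-- Patterns 213, 231, 321 (shifted to values 0,1,2).
p213 p231 p321 : Pattern
p213 = pat 3 (Fin.suc Fin.zero ∷ Fin.zero ∷ Fin.suc (Fin.suc Fin.zero) ∷ [])
p231 = pat 3 (Fin.suc Fin.zero ∷ Fin.suc (Fin.suc Fin.zero) ∷ Fin.zero ∷ [])
p321 = pat 3 (Fin.suc (Fin.suc Fin.zero) ∷ Fin.suc Fin.zero ∷ Fin.zero ∷ [])

a : ℕ → ℕ
a n = length (S2 n (p213 ∷ p231 ∷ p321 ∷ []))

-- A permutation avoids 213, 231 and 321 exactly when it is increasing
-- except at the position m of its maximum: a descent between two other entries would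
-- form one of the patterns together with the maximum.  So the avoiding permutations of
-- [N] are the N permutations maxAt (N − 1) m.  For a pair (maxAt n a, maxAt n b) the
-- third permutation maxAt n b ∘ (maxAt n a)⁻¹ is again of this form if a = n (the first
-- permutation is the identity), if a = b (the composite is the identity) or if
-- (a, b) = (n − 1, n); in every other case it contains 231 or 321.  For N = n + 1 ≥ 2
-- this gives N + (N − 1) + 1 = 2N pairs; for N = 1 the count is computed directly.

module Submission where

open import Defs
open import Data.Bool as Bool using (Bool; true; false; T; not; _∧_; _∨_)
open import Data.Bool.Properties using (T-≡; T-∧)
open import Data.Bool.ListAction using (all; any)
open import Data.Empty using (⊥)
open import Data.Fin as Fin using (Fin; toℕ; fromℕ<; #_)
open import Data.Fin.Properties using (toℕ-injective; toℕ<n; toℕ-fromℕ<)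
open import Data.List as List
  using ( List; []; _∷_; length; map; _++_; allFin; upTo; applyUpTo; concatMap; filter
        ; cartesianProductWith; cartesianProduct)
open import Data.List.Membership.Propositional using (_∈_; find; lose)
open import Data.List.Membership.Propositional.Properties
  using ( ∈-allFin; ∈-++⁺ˡ; ∈-++⁺ʳ; ∈-++⁻; ∈-map⁺; ∈-map⁻; ∈-filter⁺; ∈-filter⁻
        ; ∈-cartesianProductWith⁺; ∈-cartesianProduct⁺; ∈-cartesianProduct⁻; ∈-upTo⁺
        ; ∈-applyUpTo⁺; ∈-applyUpTo⁻)
open import Data.List.Relation.Unary.All as All using (All)
open import Data.List.Relation.Unary.All.Properties using (all⁺; all⁻; ¬All⇒Any¬; all-upTo)
open import Data.List.Extrema.Nat using (argmax; argmax-all; f[xs]≤f[argmax])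
open import Data.List.Relation.Unary.Any using (here; there; satisfied)
open import Data.List.Relation.Unary.Any.Properties using (any⁺; any⁻)
open import Data.List.Relation.Unary.Unique.Propositional using (Unique)
import Data.List.Relation.Unary.Unique.Propositional.Properties as Unique
import Data.List.Relation.Unary.AllPairs as AllPairs
open import Data.Nat
open import Data.Nat.Properties
open import Data.Product using (_×_; _,_; proj₁; proj₂; ∃-syntax)
open import Data.Sum using (_⊎_; inj₁; inj₂)
open import Data.Vec as Vec using (Vec; []; _∷_; lookup; toList)
open import Data.Vec.Properties using (lookup-map; length-toList; ∷-injective; lookup∘tabulate)
open import Function using (_⇔_; mk⇔; Equivalence; _∘_; _∘′_; case_of_)
open import Data.List.Properties using (length-++; length-applyUpTo)
open import Data.List.Membership.Propositional.Properties.WithK using (unique∧set⇒bag)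
open import Data.List.Relation.Binary.BagAndSetEquality using (∼bag⇒↭)
open import Data.List.Relation.Binary.Permutation.Propositional.Properties using (↭-length)
open import Relation.Nullary using (¬_; yes; no; contradiction)
open import Relation.Nullary.Decidable using (Dec; T?; decidable-stable; ⌊_⌋; _⊎-dec_; _×-dec_)
open import Relation.Binary.PropositionalEquality
open import Relation.Binary.Definitions using (tri<; tri≈; tri>)

open Equivalence using (to; from)

-- Occurrences of 213, 231 and 321 in a sequence F 0, …, F (L − 1)

Is213 Is231 Is321 : ℕ → ℕ → ℕ → Set
Is213 x y z = y < x × x < z
Is231 x y z = z < x × x < y
Is321 x y z = z < y × y < x

Occurs : (ℕ → ℕ → ℕ → Set) → (ℕ → ℕ) → ℕ → Set
Occurs R F L = ∃[ i ] ∃[ j ] ∃[ k ] i < j × j < k × k < L × R (F i) (F j) (F k)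

subst₃ : ∀ (R : ℕ → ℕ → ℕ → Set) {x x′ y y′ z z′} →
  x ≡ x′ → y ≡ y′ → z ≡ z′ → R x y z → R x′ y′ z′
subst₃ R refl refl refl r = r

InjectiveOn : (ℕ → ℕ) → ℕ → Set
InjectiveOn F L = ∀ {s t} → s < L → t < L → F s ≡ F t → s ≡ t

InjectiveOn-cong : ∀ {F G : ℕ → ℕ} {L} → (∀ {t} → t < L → F t ≡ G t) → InjectiveOn F L → InjectiveOn G L
InjectiveOn-cong F≗G F-injective s<L t<L Gs≡Gt =
  F-injective s<L t<L (trans (F≗G s<L) (trans Gs≡Gt (sym (F≗G t<L))))

Avoids₃ : (ℕ → ℕ) → ℕ → Set
Avoids₃ F L = ¬ Occurs Is213 F L × ¬ Occurs Is231 F L × ¬ Occurs Is321 F L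

Occurs-cong : ∀ R {F G : ℕ → ℕ} {L} → (∀ {t} → t < L → F t ≡ G t) → Occurs R F L → Occurs R G L
Occurs-cong R F≗G (i , j , k , i<j , j<k , k<L , r) =
  i , j , k , i<j , j<k , k<L , subst₃ R (F≗G (<-trans i<j (<-trans j<k k<L))) (F≗G (<-trans j<k k<L)) (F≗G k<L) r

Avoids₃-cong : ∀ {F G : ℕ → ℕ} {L} → (∀ {t} → t < L → F t ≡ G t) → Avoids₃ F L → Avoids₃ G L
Avoids₃-cong F≗G (¬213 , ¬231 , ¬321) =
  ¬213 ∘ Occurs-cong Is213 (sym ∘ F≗G) ,
  ¬231 ∘ Occurs-cong Is231 (sym ∘ F≗G) ,
  ¬321 ∘ Occurs-cong Is321 (sym ∘ F≗G)

IncreasingExcept : (ℕ → ℕ) → ℕ → ℕ → Set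
IncreasingExcept F m L = ∀ {s t} → s < t → t < L → s ≢ m → t ≢ m → F s < F t

MaximumAt : (ℕ → ℕ) → ℕ → ℕ → Set
MaximumAt F m L = ∀ {t} → t < L → t ≢ m → F t < F m

module _ {F : ℕ → ℕ} {m L : ℕ} (inc : IncreasingExcept F m L) (max : MaximumAt F m L) where

  increasingExcept⇒Avoids₃ : Avoids₃ F L
  increasingExcept⇒Avoids₃ = ¬213 , ¬231 , ¬321
    where
    ¬213 : ¬ Occurs Is213 F L
    ¬213 (i , j , k , i<j , j<k , k<L , Fj<Fi , Fi<Fk) with j ≟ m | i ≟ m
    ... | yes refl | _        = <-asym Fj<Fi (max (<-trans i<j (<-trans j<k k<L)) (<⇒≢ i<j))
    ... | no _     | yes refl = <-asym Fi<Fk (max k<L (>⇒≢ (<-trans i<j j<k)))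
    ... | no j≢m   | no i≢m   = <-asym Fj<Fi (inc i<j (<-trans j<k k<L) i≢m j≢m)

    ¬231 : ¬ Occurs Is231 F L
    ¬231 (i , j , k , i<j , j<k , k<L , Fk<Fi , Fi<Fj) with i ≟ m | k ≟ m
    ... | yes refl | _        = <-asym Fi<Fj (max (<-trans j<k k<L) (>⇒≢ i<j))
    ... | no i≢m   | yes refl = <-asym Fk<Fi (max (<-trans (<-trans i<j j<k) k<L) i≢m)
    ... | no i≢m   | no k≢m   = <-asym Fk<Fi (inc (<-trans i<j j<k) k<L i≢m k≢m)

    ¬321 : ¬ Occurs Is321 F L
    ¬321 (i , j , k , i<j , j<k , k<L , Fk<Fj , Fj<Fi) with i ≟ m | j ≟ m
    ... | yes refl | _        = <-asym Fk<Fj (inc j<k k<L (>⇒≢ i<j) (>⇒≢ (<-trans i<j j<k)))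
    ... | no i≢m   | yes refl = <-asym Fj<Fi (max (<-trans i<j (<-trans j<k k<L)) i≢m)
    ... | no i≢m   | no j≢m   = <-asym Fj<Fi (inc i<j (<-trans j<k k<L) i≢m j≢m)

  increasingExcept⇒distinct : ∀ {s t} → s < t → t < L → F s ≢ F t
  increasingExcept⇒distinct {s} {t} s<t t<L with s ≟ m | t ≟ m
  ... | yes refl | yes refl = contradiction s<t (n≮n s)
  ... | yes refl | no t≢m   = >⇒≢ (max t<L t≢m)
  ... | no s≢m   | yes refl = <⇒≢ (max (<-trans s<t t<L) s≢m)
  ... | no s≢m   | no t≢m   = <⇒≢ (inc s<t t<L s≢m t≢m)

  increasingExcept⇒InjectiveOn : InjectiveOn F L
  increasingExcept⇒InjectiveOn s<L t<L Fs≡Ft with <-cmp _ _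
  ... | tri< s<t _ _ = contradiction Fs≡Ft (increasingExcept⇒distinct s<t t<L)
  ... | tri≈ _ s≡t _ = s≡t
  ... | tri> _ _ t<s = contradiction (sym Fs≡Ft) (increasingExcept⇒distinct t<s s<L)

increasing-bounded⇒id : ∀ {L} (h : ℕ → ℕ) → (∀ {t} → suc t < L → h t < h (suc t)) →
  (∀ {t} → t < L → h t < L) → ∀ {t} → t < L → h t ≡ t
increasing-bounded⇒id {L} h inc bounded {t} t<L = ≤-antisym (≤-pred h[t]<1+t) (above t<L)
  where
  above : ∀ {t} → t < L → t ≤ h t
  above {zero}  _     = z≤n
  above {suc t} t+1<L = ≤-<-trans (above (<-trans (n<1+n t) t+1<L)) (inc t+1<L)

  climb : ∀ d {t} → t + d < L → h t + d ≤ h (t + d)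
  climb zero    {t} _ rewrite +-identityʳ t | +-identityʳ (h t) = ≤-refl
  climb (suc d) {t} t+d+1<L rewrite +-suc t d | +-suc (h t) d =
    ≤-trans (+-monoˡ-≤ d (inc (≤-<-trans (m≤m+n (suc t) d) t+d+1<L))) (climb d t+d+1<L)

  gap : ℕ
  gap = L ∸ suc t
  t+1+gap≡L : suc t + gap ≡ L
  t+1+gap≡L = m+[n∸m]≡n t<L

  h[t]<1+t : h t < suc t
  h[t]<1+t = +-cancelʳ-< gap (h t) (suc t) (begin-strict
    h t + gap     ≤⟨ climb gap (≤-reflexive t+1+gap≡L) ⟩
    h (t + gap)   <⟨ bounded (≤-reflexive t+1+gap≡L) ⟩
    L             ≡⟨ t+1+gap≡L ⟨
    suc t + gap   ∎)
    where open ≤-Reasoning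

maxAt : ℕ → ℕ → ℕ → ℕ
maxAt n m t with <-cmp t m
... | tri< _ _ _ = t
... | tri≈ _ _ _ = n
... | tri> _ _ _ = pred t

module _ {n m : ℕ} where

  maxAt-< : ∀ {t} → t < m → maxAt n m t ≡ t
  maxAt-< {t} t<m with <-cmp t m
  ... | tri< _ _ _    = refl
  ... | tri≈ t≮m _ _  = contradiction t<m t≮m
  ... | tri> t≮m _ _  = contradiction t<m t≮m

  maxAt-≡ : maxAt n m m ≡ n
  maxAt-≡ with <-cmp m m
  ... | tri< _ m≢m _ = contradiction refl m≢m
  ... | tri≈ _ _ _   = refl
  ... | tri> _ m≢m _ = contradiction refl m≢m

  maxAt-> : ∀ {t} → m < t → maxAt n m t ≡ pred t
  maxAt-> {t} m<t with <-cmp t m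
  ... | tri< _ _ t≯m  = contradiction m<t t≯m
  ... | tri≈ _ _ t≯m  = contradiction m<t t≯m
  ... | tri> _ _ _    = refl

  maxAt-increasingExcept : IncreasingExcept (maxAt n m) m (suc n)
  maxAt-increasingExcept {s} {t} s<t _ s≢m t≢m with <-cmp s m | <-cmp t m
  ... | tri≈ _ s≡m _ | _            = contradiction s≡m s≢m
  ... | _            | tri≈ _ t≡m _ = contradiction t≡m t≢m
  ... | tri< _ _ _   | tri< _ _ _   = s<t
  ... | tri< s<m _ _ | tri> _ _ m<t = <-≤-trans s<m (<⇒≤pred m<t)
  ... | tri> _ _ m<s | tri< t<m _ _ = contradiction (<-trans m<s s<t) (<⇒≯ t<m)
  ... | tri> _ _ m<s | tri> _ _ _   = pred-mono-< {{>-nonZero (≤-<-trans z≤n m<s)}} s<t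

  maxAt-maximumAt : m < suc n → MaximumAt (maxAt n m) m (suc n)
  maxAt-maximumAt m<1+n {t} t<1+n t≢m rewrite maxAt-≡ with <-cmp t m
  ... | tri< t<m _ _ = <-≤-trans t<m (≤-pred m<1+n)
  ... | tri≈ _ t≡m _ = contradiction t≡m t≢m
  ... | tri> _ _ m<t = pred-mono-< {{>-nonZero (≤-<-trans z≤n m<t)}} t<1+n

  maxAt-bounded : ∀ {t} → t < suc n → maxAt n m t < suc n
  maxAt-bounded {t} t<1+n with <-cmp t m
  ... | tri< _ _ _ = t<1+n
  ... | tri≈ _ _ _ = n<1+n n
  ... | tri> _ _ _ = ≤-<-trans pred[n]≤n t<1+n

skip : ℕ → ℕ → ℕ
skip m t with t <? m
... | yes _ = t
... | no  _ = suc t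

module _ {m : ℕ} where

  skip-< : ∀ {t} → t < m → skip m t ≡ t
  skip-< {t} t<m with t <? m
  ... | yes _   = refl
  ... | no  t≮m = contradiction t<m t≮m

  skip-≥ : ∀ {t} → m ≤ t → skip m t ≡ suc t
  skip-≥ {t} m≤t with t <? m
  ... | yes t<m = contradiction m≤t (<⇒≱ t<m)
  ... | no  _   = refl

  skip≢ : ∀ t → skip m t ≢ m
  skip≢ t with t <? m
  ... | yes t<m = <⇒≢ t<m
  ... | no  t≮m = λ t+1≡m → t≮m (subst (t <_) t+1≡m (n<1+n t))

  skip-≤ : ∀ t → skip m t ≤ suc t
  skip-≤ t with t <? m
  ... | yes _ = n≤1+n t
  ... | no  _ = ≤-refl

  skip-increasing : ∀ t → skip m t < skip m (suc t)
  skip-increasing t with t <? m | suc t <? m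
  ... | yes _   | yes _     = n<1+n t
  ... | yes _   | no  _     = m<n⇒m<1+n (n<1+n t)
  ... | no  t≮m | yes t+1<m = contradiction (<-trans (n<1+n t) t+1<m) t≮m
  ... | no  _   | no  _     = n<1+n (suc t)

argmax< : (F : ℕ → ℕ) (n : ℕ) → ∃[ m ] m < suc n × (∀ {t} → t < suc n → F t ≤ F m)
argmax< F n = argmax F 0 (upTo (suc n)) , argmax-all F z<s (all-upTo (suc n)) ,
  λ t<1+n → All.lookup (f[xs]≤f[argmax] {f = F} 0 (upTo (suc n))) (∈-upTo⁺ t<1+n)

Avoids₃⇒increasingExcept : ∀ {F m L} → Avoids₃ F L → InjectiveOn F L → m < L → MaximumAt F m L →
  IncreasingExcept F m L
Avoids₃⇒increasingExcept {F} {m} (¬213 , ¬231 , ¬321) F-injective m<L max {s} {t} s<t t<L s≢m t≢m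
  with <-cmp (F s) (F t)
... | tri< Fs<Ft _ _ = Fs<Ft
... | tri≈ _ Fs≡Ft _ = contradiction (F-injective (<-trans s<t t<L) t<L Fs≡Ft) (<⇒≢ s<t)
... | tri> _ _ Ft<Fs with max (<-trans s<t t<L) s≢m | <-cmp t m | <-cmp s m
... | _     | tri≈ _ t≡m _ | _            = contradiction t≡m t≢m
... | _     | _            | tri≈ _ s≡m _ = contradiction s≡m s≢m
... | Fs<Fm | tri< t<m _ _ | _            = contradiction (s , t , m , s<t , t<m , m<L , Ft<Fs , Fs<Fm) ¬213
... | Fs<Fm | tri> _ _ m<t | tri< s<m _ _ = contradiction (s , m , t , s<m , m<t , t<L , Ft<Fs , Fs<Fm) ¬231
... | Fs<Fm | tri> _ _ _   | tri> _ _ m<s = contradiction (m , s , t , m<s , s<t , t<L , Ft<Fs , Fs<Fm) ¬321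

module _ {n : ℕ} {F : ℕ → ℕ} (F-bounded : ∀ {t} → t < suc n → F t < suc n)
         {m : ℕ} (m<1+n : m < suc n) (max : MaximumAt F m (suc n))
         (inc : IncreasingExcept F m (suc n)) where

  private
    h : ℕ → ℕ
    h t = F (skip m t)

    skip<1+n : ∀ {t} → t < n → skip m t < suc n
    skip<1+n {t} t<n = s≤s (≤-trans (skip-≤ t) t<n)

    h<Fm : ∀ {t} → t < n → h t < F m
    h<Fm {t} t<n = max (skip<1+n t<n) (skip≢ t)

    h≡id : ∀ {t} → t < n → h t ≡ t
    h≡id = increasing-bounded⇒id h
      (λ {t} t+1<n → inc (skip-increasing t) (skip<1+n t+1<n) (skip≢ t) (skip≢ (suc t)))
      (λ t<n → <-≤-trans (h<Fm t<n) (≤-pred (F-bounded m<1+n)))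

    Fm≡n : F m ≡ n
    Fm≡n = ≤-antisym (≤-pred (F-bounded m<1+n)) (≮⇒≥ λ Fm<n → <-irrefl (h≡id Fm<n) (h<Fm Fm<n))

  -- Off position m, F is increasing with values below F m ≤ n, so it is the identity
  -- read around m.
  increasingExcept⇒maxAt : ∀ {t} → t < suc n → F t ≡ maxAt n m t
  increasingExcept⇒maxAt {t} t<1+n with <-cmp t m
  ... | tri< t<m _ _ = trans (cong F (sym (skip-< t<m))) (h≡id (<-≤-trans t<m (≤-pred m<1+n)))
  ... | tri≈ _ refl _ = Fm≡n
  increasingExcept⇒maxAt {suc t} t+1<1+n | tri> _ _ m<t+1 =
    trans (cong F (sym (skip-≥ (≤-pred m<t+1)))) (h≡id (≤-pred t+1<1+n))

Avoids₃⇒maxAt : ∀ {n F} → (∀ {t} → t < suc n → F t < suc n) →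
  InjectiveOn F (suc n) → Avoids₃ F (suc n) →
  ∃[ m ] m < suc n × ∀ {t} → t < suc n → F t ≡ maxAt n m t
Avoids₃⇒maxAt {n} {F} F-bounded F-injective avoid with argmax< F n
... | m , m<1+n , F≤Fm = m , m<1+n , increasingExcept⇒maxAt F-bounded m<1+n max
  (Avoids₃⇒increasingExcept avoid F-injective m<1+n max)
  where
  max : MaximumAt F m (suc n)
  max t<1+n t≢m = ≤∧≢⇒< (F≤Fm t<1+n) (t≢m ∘ F-injective t<1+n m<1+n)

-- Compositions of two permutations of the form maxAt

maxAt⁻¹ : ℕ → ℕ → ℕ → ℕ
maxAt⁻¹ n a v with v <? a
... | yes _ = v
... | no  _ with v ≟ n
...   | yes _ = a
...   | no  _ = suc v

module _ {n a : ℕ} where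

  maxAt⁻¹-< : ∀ {v} → v < a → maxAt⁻¹ n a v ≡ v
  maxAt⁻¹-< {v} v<a with v <? a
  ... | yes _   = refl
  ... | no  v≮a = contradiction v<a v≮a

  maxAt⁻¹-max : a < suc n → maxAt⁻¹ n a n ≡ a
  maxAt⁻¹-max a<1+n with n <? a
  ... | yes n<a = contradiction (≤-pred a<1+n) (<⇒≱ n<a)
  ... | no  _ with n ≟ n
  ...   | yes _   = refl
  ...   | no  n≢n = contradiction refl n≢n

  maxAt⁻¹-≥ : ∀ {v} → a ≤ v → v ≢ n → maxAt⁻¹ n a v ≡ suc v
  maxAt⁻¹-≥ {v} a≤v v≢n with v <? a
  ... | yes v<a = contradiction a≤v (<⇒≱ v<a)
  ... | no  _ with v ≟ n
  ...   | yes v≡n = contradiction v≡n v≢n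
  ...   | no  _   = refl

  maxAt⁻¹-bounded : a < suc n → ∀ {v} → v < suc n → maxAt⁻¹ n a v < suc n
  maxAt⁻¹-bounded a<1+n {v} v<1+n with v <? a
  ... | yes _ = v<1+n
  ... | no  _ with v ≟ n
  ...   | yes _   = a<1+n
  ...   | no  v≢n = s≤s (≤∧≢⇒< (≤-pred v<1+n) v≢n)

  maxAt-maxAt⁻¹ : a < suc n → ∀ {v} → v < suc n → maxAt n a (maxAt⁻¹ n a v) ≡ v
  maxAt-maxAt⁻¹ a<1+n {v} v<1+n with ≤-<-connex a v
  ... | inj₂ v<a = trans (cong (maxAt n a) (maxAt⁻¹-< v<a)) (maxAt-< v<a)
  ... | inj₁ a≤v with m≤n⇒m<n∨m≡n (≤-pred v<1+n)
  ...   | inj₁ v<n  = trans (cong (maxAt n a) (maxAt⁻¹-≥ a≤v (<⇒≢ v<n))) (maxAt-> (s≤s a≤v))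
  ...   | inj₂ refl = trans (cong (maxAt n a) (maxAt⁻¹-max a<1+n)) (maxAt-≡ {n} {a})

maxAt-id : ∀ {n t} → t < suc n → maxAt n n t ≡ t
maxAt-id {n} {t} t<1+n with m≤n⇒m<n∨m≡n (≤-pred t<1+n)
... | inj₁ t<n  = maxAt-< t<n
... | inj₂ refl = maxAt-≡ {n} {n}

maxAt⁻¹-id : ∀ {n t} → t < suc n → maxAt⁻¹ n n t ≡ t
maxAt⁻¹-id {n} {t} t<1+n with m≤n⇒m<n∨m≡n (≤-pred t<1+n)
... | inj₁ t<n  = maxAt⁻¹-< t<n
... | inj₂ refl = maxAt⁻¹-max (n<1+n t)

maxAt⁻¹≡maxAt : ∀ {k t} → t < suc (suc k) → maxAt⁻¹ (suc k) k t ≡ maxAt (suc k) k t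
maxAt⁻¹≡maxAt {k} {t} t<2+k with <-cmp t k
... | tri< t<k _ _ = maxAt⁻¹-< t<k
... | tri≈ _ refl _ = maxAt⁻¹-≥ ≤-refl (<⇒≢ (n<1+n t))
... | tri> _ _ k<t with m≤n⇒m<n∨m≡n (≤-pred t<2+k)
...   | inj₁ t<1+k  = contradiction (≤-pred t<1+k) (<⇒≱ k<t)
...   | inj₂ refl   = maxAt⁻¹-max (m<n⇒m<1+n (n<1+n k))

-- The pairs (a, b) for which maxAt n b ∘ (maxAt n a)⁻¹ is again of the form maxAt n c.
Compatible : ℕ → ℕ → ℕ → Set
Compatible n a b = a ≡ n ⊎ b ≡ a ⊎ (suc a ≡ n × b ≡ n)

Compatible? : ∀ n a b → Dec (Compatible n a b)
Compatible? n a b = a ≟ n ⊎-dec (b ≟ a ⊎-dec (suc a ≟ n ×-dec b ≟ n))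

compatible⇒maxAt : ∀ {n a b} → a < suc n → b < suc n → Compatible n a b →
  ∃[ c ] c < suc n × ∀ {t} → t < suc n → maxAt n b (maxAt⁻¹ n a t) ≡ maxAt n c t
compatible⇒maxAt {b = b} _ b<1+n (inj₁ refl) =
  b , b<1+n , λ t<1+n → cong (maxAt _ b) (maxAt⁻¹-id t<1+n)
compatible⇒maxAt {n} a<1+n _ (inj₂ (inj₁ refl)) =
  n , n<1+n n , λ t<1+n → trans (maxAt-maxAt⁻¹ a<1+n t<1+n) (sym (maxAt-id t<1+n))
compatible⇒maxAt {a = k} a<1+n _ (inj₂ (inj₂ (refl , refl))) =
  k , a<1+n , λ t<1+n → trans (maxAt-id (maxAt⁻¹-bounded a<1+n t<1+n)) (maxAt⁻¹≡maxAt t<1+n)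

Occurs-at : ∀ (R : ℕ → ℕ → ℕ → Set) {F L i j k x y z} → i < j → j < k → k < L →
  F i ≡ x → F j ≡ y → F k ≡ z → R x y z → Occurs R F L
Occurs-at R i<j j<k k<L refl refl refl r = _ , _ , _ , i<j , j<k , k<L , r

-- Witness positions: (b, a, n) if b < a, (a, a + 1, n) if b = a + 1 < n,
-- and (a, b − 1, n) if a + 1 < b.
¬compatible⇒¬Avoids₃ : ∀ {n a b} → a < suc n → b < suc n → ¬ Compatible n a b →
  ¬ Avoids₃ (maxAt n b ∘ maxAt⁻¹ n a) (suc n)
¬compatible⇒¬Avoids₃ {n} {a} {b} a<1+n b<1+n incompatible (_ , ¬231 , ¬321) with a ≟ n
... | yes a≡n = incompatible (inj₁ a≡n)
... | no  a≢n with <-cmp b a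
...   | tri≈ _ b≡a _ = incompatible (inj₂ (inj₁ b≡a))
...   | tri< b<a _ _ = ¬321 (Occurs-at Is321 b<a a<n (n<1+n n)
        (trans (cong (maxAt n b) (maxAt⁻¹-< b<a)) (maxAt-≡ {n} {b}))
        (trans (cong (maxAt n b) (maxAt⁻¹-≥ ≤-refl a≢n)) (maxAt-> (m<n⇒m<1+n b<a)))
        (trans (cong (maxAt n b) (maxAt⁻¹-max a<1+n)) (maxAt-> b<a))
        (pred-mono-< {{>-nonZero (≤-<-trans z≤n b<a)}} (n<1+n a) , a<n))
  where
  a<n : a < n
  a<n = ≤∧≢⇒< (≤-pred a<1+n) a≢n
...   | tri> _ _ a<b with suc a ≟ b
...     | yes refl = ¬321 (Occurs-at Is321 (n<1+n a) a+1<n (n<1+n n)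
          (trans (cong (maxAt n b) (maxAt⁻¹-≥ ≤-refl a≢n)) (maxAt-≡ {n} {b}))
          (trans (cong (maxAt n b) (maxAt⁻¹-≥ (n≤1+n a) (<⇒≢ a+1<n))) (maxAt-> (n<1+n b)))
          (trans (cong (maxAt n b) (maxAt⁻¹-max a<1+n)) (maxAt-< a<b))
          (n<1+n a , a+1<n))
  where
  a+1<n : suc a < n
  a+1<n = ≤∧≢⇒< (≤-pred b<1+n) λ a+1≡n → incompatible (inj₂ (inj₂ (a+1≡n , a+1≡n)))
¬compatible⇒¬Avoids₃ {n} {a} {suc b} a<1+n b+1<1+n _ (_ , ¬231 , _)
  | no a≢n | tri> _ _ a<b+1 | no a+1≢b+1 = ¬231 (Occurs-at Is231 a<b b<n (n<1+n n)
    (trans (cong (maxAt n (suc b)) (maxAt⁻¹-≥ ≤-refl a≢n)) (maxAt-< (s≤s a<b)))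
    (trans (cong (maxAt n (suc b)) (maxAt⁻¹-≥ (<⇒≤ a<b) (<⇒≢ b<n))) (maxAt-≡ {n} {suc b}))
    (trans (cong (maxAt n (suc b)) (maxAt⁻¹-max a<1+n)) (maxAt-< a<b+1))
    (n<1+n a , <-≤-trans (s≤s a<b) (≤-pred b+1<1+n)))
  where
  a<b : a < b
  a<b = ≤∧≢⇒< (≤-pred a<b+1) (a+1≢b+1 ∘ cong suc)
  b<n : b < n
  b<n = ≤-pred b+1<1+n

-- The Boolean definitions of Defs

<⇒<ᵇ≡true : ∀ {m n} → m < n → (m <ᵇ n) ≡ true
<⇒<ᵇ≡true = to T-≡ ∘ <⇒<ᵇ

<ᵇ≡true⇒< : ∀ {m n} → (m <ᵇ n) ≡ true → m < n
<ᵇ≡true⇒< {m} {n} = <ᵇ⇒< m n ∘ from T-≡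

≮⇒<ᵇ≡false : ∀ {m n} → ¬ m < n → (m <ᵇ n) ≡ false
≮⇒<ᵇ≡false {m} {n} m≮n with m <ᵇ n in eq
... | false = refl
... | true  = contradiction (<ᵇ≡true⇒< eq) m≮n

n<ᵇn≡false : ∀ n → (n <ᵇ n) ≡ false
n<ᵇn≡false n = ≮⇒<ᵇ≡false (n≮n n)

¬all⇒∃¬ : ∀ {A : Set} (p : A → Bool) xs → ¬ T (all p xs) → ∃[ x ] ¬ T (p x)
¬all⇒∃¬ p xs ¬all = satisfied (¬All⇒Any¬ (λ x → T? (p x)) xs (λ all-p → ¬all (all⁻ p all-p)))

OrderIso : ∀ {n k} → Vec (Fin k) k → Vec (Fin n) k → Set
OrderIso {k = k} π w = ∀ (i j : Fin k) →
  (toℕ (lookup w i) <ᵇ toℕ (lookup w j)) ≡ (toℕ (lookup π i) <ᵇ toℕ (lookup π j))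

-- The comparison inside orderIso is a local function of Defs and cannot be named;
-- both directions therefore generalise the two comparisons with 'with' and let the
-- hidden function compute on the resulting constructors.
orderIso⇔OrderIso : ∀ {n k} (π : Vec (Fin k) k) (w : Vec (Fin n) k) → T (orderIso π w) ⇔ OrderIso π w
orderIso⇔OrderIso {k = k} π w = mk⇔ agreement (decidable-stable (T? _) ∘′ refute)
  where
  agreement : T (orderIso π w) → OrderIso π w
  agreement iso i j
    with toℕ (lookup w i) <ᵇ toℕ (lookup w j) | toℕ (lookup π i) <ᵇ toℕ (lookup π j)
       | All.lookup (all⁺ _ _ (All.lookup (all⁺ _ _ iso) (∈-allFin i))) (∈-allFin j)
  ... | true  | true  | _  = refl
  ... | false | false | _  = refl
  ... | true  | false | ()
  ... | false | true  | ()

  refute : OrderIso π w → ¬ T (orderIso π w) → ⊥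
  refute agree ¬iso with ¬all⇒∃¬ _ (allFin k) ¬iso
  ... | i , ¬row with ¬all⇒∃¬ _ (allFin k) ¬row
  ... | j , ¬entry
    with toℕ (lookup w i) <ᵇ toℕ (lookup w j) | toℕ (lookup π i) <ᵇ toℕ (lookup π j)
       | agree i j | ¬entry
  ... | true  | .true  | refl | ¬e = ¬e _
  ... | false | .false | refl | ¬e = ¬e _

relabel-OrderIso : ∀ {n k} (π : Vec (Fin k) k) (f : Fin k → Fin n) →
  (∀ u v → toℕ u < toℕ v → toℕ (f u) < toℕ (f v)) → OrderIso π (Vec.map f π)
relabel-OrderIso π f f-mono i j
  rewrite lookup-map i f π | lookup-map j f π
  with <-cmp (toℕ (lookup π i)) (toℕ (lookup π j))
... | tri< u<v _ _ = trans (<⇒<ᵇ≡true (f-mono _ _ u<v)) (sym (<⇒<ᵇ≡true u<v))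
... | tri> _ _ v<u = trans (≮⇒<ᵇ≡false (<⇒≯ (f-mono _ _ v<u))) (sym (≮⇒<ᵇ≡false (<⇒≯ v<u)))
... | tri≈ _ u≡v _ rewrite toℕ-injective u≡v =
  trans (n<ᵇn≡false (toℕ (f (lookup π j)))) (sym (n<ᵇn≡false (toℕ (lookup π j))))

sorted₃-increasing : ∀ {n} {p q r : Fin n} → toℕ p < toℕ q → toℕ q < toℕ r →
  ∀ (u v : Fin 3) → toℕ u < toℕ v →
  toℕ (lookup (p ∷ q ∷ r ∷ []) u) < toℕ (lookup (p ∷ q ∷ r ∷ []) v)
sorted₃-increasing p<q q<r Fin.zero       (Fin.suc Fin.zero)           _ = p<q
sorted₃-increasing p<q q<r Fin.zero       (Fin.suc (Fin.suc Fin.zero)) _ = <-trans p<q q<r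
sorted₃-increasing p<q q<r (Fin.suc Fin.zero) (Fin.suc (Fin.suc Fin.zero)) _ = q<r
sorted₃-increasing p<q q<r _ Fin.zero ()
sorted₃-increasing p<q q<r (Fin.suc Fin.zero) (Fin.suc Fin.zero) (s≤s ())
sorted₃-increasing p<q q<r (Fin.suc (Fin.suc Fin.zero)) (Fin.suc Fin.zero) (s≤s ())
sorted₃-increasing p<q q<r (Fin.suc (Fin.suc Fin.zero)) (Fin.suc (Fin.suc Fin.zero)) (s≤s (s≤s ()))

Characterises : Vec (Fin 3) 3 → (ℕ → ℕ → ℕ → Set) → Set
Characterises π R = ∀ {n} (x y z : Fin n) → T (orderIso π (x ∷ y ∷ z ∷ [])) ⇔ R (toℕ x) (toℕ y) (toℕ z)

characterise : ∀ π (R : ℕ → ℕ → ℕ → Set) →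
  (∀ {n} {x y z : Fin n} → OrderIso π (x ∷ y ∷ z ∷ []) → R (toℕ x) (toℕ y) (toℕ z)) →
  (∀ {n} {x y z : Fin n} → R (toℕ x) (toℕ y) (toℕ z) → OrderIso π (x ∷ y ∷ z ∷ [])) →
  Characterises π R
characterise π R sound complete x y z =
  mk⇔ (sound ∘′ to (orderIso⇔OrderIso π w)) (from (orderIso⇔OrderIso π w) ∘′ complete)
  where
  w : Vec (Fin _) 3
  w = x ∷ y ∷ z ∷ []

characterises213 : Characterises (Pattern.word p213) Is213
characterises213 = characterise (Pattern.word p213) Is213
  (λ agree → <ᵇ≡true⇒< (agree (# 1) (# 0)) , <ᵇ≡true⇒< (agree (# 0) (# 2)))
  (λ {_} {x} {y} {z} (y<x , x<z) →
    relabel-OrderIso (Pattern.word p213) (lookup (y ∷ x ∷ z ∷ [])) (sorted₃-increasing y<x x<z))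

characterises231 : Characterises (Pattern.word p231) Is231
characterises231 = characterise (Pattern.word p231) Is231
  (λ agree → <ᵇ≡true⇒< (agree (# 2) (# 0)) , <ᵇ≡true⇒< (agree (# 0) (# 1)))
  (λ {_} {x} {y} {z} (z<x , x<y) →
    relabel-OrderIso (Pattern.word p231) (lookup (z ∷ x ∷ y ∷ [])) (sorted₃-increasing z<x x<y))

characterises321 : Characterises (Pattern.word p321) Is321
characterises321 = characterise (Pattern.word p321) Is321
  (λ agree → <ᵇ≡true⇒< (agree (# 2) (# 1)) , <ᵇ≡true⇒< (agree (# 1) (# 0)))
  (λ {_} {x} {y} {z} (z<y , y<x) →
    relabel-OrderIso (Pattern.word p321) (lookup (z ∷ y ∷ x ∷ [])) (sorted₃-increasing z<y y<x))

-- Entries beyond the end of the list read as 0.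
entry : ∀ {n} → List (Fin n) → ℕ → ℕ
entry []       _       = 0
entry (x ∷ _)  zero    = toℕ x
entry (_ ∷ xs) (suc t) = entry xs t

⟦_⟧ : ∀ {n m} → Vec (Fin n) m → ℕ → ℕ
⟦ v ⟧ = entry (toList v)

module _ {n : ℕ} where

  ∈-subseqs₁⁺ : ∀ (xs : List (Fin n)) {i} → i < length xs →
    ∃[ x ] (x ∷ []) ∈ subseqs 1 xs × toℕ x ≡ entry xs i
  ∈-subseqs₁⁺ (x ∷ xs) {zero}  _         = x , here refl , refl
  ∈-subseqs₁⁺ (x ∷ xs) {suc i} (s≤s i<l) with ∈-subseqs₁⁺ xs i<l
  ... | y , y∈ , eq = y , ∈-++⁺ʳ _ y∈ , eq

  ∈-subseqs₂⁺ : ∀ (xs : List (Fin n)) {i j} → i < j → j < length xs →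
    ∃[ x ] ∃[ y ] (x ∷ y ∷ []) ∈ subseqs 2 xs × toℕ x ≡ entry xs i × toℕ y ≡ entry xs j
  ∈-subseqs₂⁺ (x ∷ xs) {zero}  {suc j} _         (s≤s j<l) with ∈-subseqs₁⁺ xs j<l
  ... | y , y∈ , eq = x , y , ∈-++⁺ˡ (∈-map⁺ (x ∷_) y∈) , refl , eq
  ∈-subseqs₂⁺ (x ∷ xs) {suc i} {suc j} (s≤s i<j) (s≤s j<l) with ∈-subseqs₂⁺ xs i<j j<l
  ... | y , z , yz∈ , eq₁ , eq₂ = y , z , ∈-++⁺ʳ _ yz∈ , eq₁ , eq₂

  ∈-subseqs₃⁺ : ∀ (xs : List (Fin n)) {i j k} → i < j → j < k → k < length xs →
    ∃[ x ] ∃[ y ] ∃[ z ] (x ∷ y ∷ z ∷ []) ∈ subseqs 3 xs ×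
      toℕ x ≡ entry xs i × toℕ y ≡ entry xs j × toℕ z ≡ entry xs k
  ∈-subseqs₃⁺ (x ∷ xs) {zero}  {suc j} {suc k} _ (s≤s j<k) (s≤s k<l) with ∈-subseqs₂⁺ xs j<k k<l
  ... | y , z , yz∈ , eq₁ , eq₂ = x , y , z , ∈-++⁺ˡ (∈-map⁺ (x ∷_) yz∈) , refl , eq₁ , eq₂
  ∈-subseqs₃⁺ (x ∷ xs) {suc i} {suc j} {suc k} (s≤s i<j) (s≤s j<k) (s≤s k<l)
    with ∈-subseqs₃⁺ xs i<j j<k k<l
  ... | u , v , w , uvw∈ , eq₁ , eq₂ , eq₃ = u , v , w , ∈-++⁺ʳ _ uvw∈ , eq₁ , eq₂ , eq₃

  ∈-subseqs₁⁻ : ∀ (xs : List (Fin n)) {x} → (x ∷ []) ∈ subseqs 1 xs →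
    ∃[ i ] i < length xs × toℕ x ≡ entry xs i
  ∈-subseqs₁⁻ (y ∷ xs) x∈ with ∈-++⁻ (map (y ∷_) (subseqs 0 xs)) x∈
  ... | inj₁ (here refl) = zero , s≤s z≤n , refl
  ... | inj₂ x∈′ with ∈-subseqs₁⁻ xs x∈′
  ... | i , i<l , eq = suc i , s≤s i<l , eq

  ∈-subseqs₂⁻ : ∀ (xs : List (Fin n)) {x y} → (x ∷ y ∷ []) ∈ subseqs 2 xs →
    ∃[ i ] ∃[ j ] i < j × j < length xs × toℕ x ≡ entry xs i × toℕ y ≡ entry xs j
  ∈-subseqs₂⁻ (u ∷ xs) xy∈ with ∈-++⁻ (map (u ∷_) (subseqs 1 xs)) xy∈
  ... | inj₁ xy∈′ with ∈-map⁻ (u ∷_) xy∈′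
  ... | _ , y∈ , refl with ∈-subseqs₁⁻ xs y∈
  ... | j , j<l , eq = zero , suc j , s≤s z≤n , s≤s j<l , refl , eq
  ∈-subseqs₂⁻ (u ∷ xs) xy∈ | inj₂ xy∈′ with ∈-subseqs₂⁻ xs xy∈′
  ... | i , j , i<j , j<l , eq₁ , eq₂ = suc i , suc j , s≤s i<j , s≤s j<l , eq₁ , eq₂

  ∈-subseqs₃⁻ : ∀ (xs : List (Fin n)) {x y z} → (x ∷ y ∷ z ∷ []) ∈ subseqs 3 xs →
    ∃[ i ] ∃[ j ] ∃[ k ] i < j × j < k × k < length xs ×
      toℕ x ≡ entry xs i × toℕ y ≡ entry xs j × toℕ z ≡ entry xs k
  ∈-subseqs₃⁻ (u ∷ xs) xyz∈ with ∈-++⁻ (map (u ∷_) (subseqs 2 xs)) xyz∈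
  ... | inj₁ xyz∈′ with ∈-map⁻ (u ∷_) xyz∈′
  ... | _ , yz∈ , refl with ∈-subseqs₂⁻ xs yz∈
  ... | j , k , j<k , k<l , eq₁ , eq₂ = zero , suc j , suc k , s≤s z≤n , s≤s j<k , s≤s k<l , refl , eq₁ , eq₂
  ∈-subseqs₃⁻ (u ∷ xs) xyz∈ | inj₂ xyz∈′ with ∈-subseqs₃⁻ xs xyz∈′
  ... | i , j , k , i<j , j<k , k<l , eq₁ , eq₂ , eq₃ =
    suc i , suc j , suc k , s≤s i<j , s≤s j<k , s≤s k<l , eq₁ , eq₂ , eq₃

module _ {π : Vec (Fin 3) 3} {R : ℕ → ℕ → ℕ → Set} (π≈R : Characterises π R) {n : ℕ} where

  contains⇒Occurs : ∀ (xs : List (Fin n)) → T (any (orderIso π) (subseqs 3 xs)) → Occurs R (entry xs) (length xs)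
  contains⇒Occurs xs c with find (any⁻ (orderIso π) (subseqs 3 xs) c)
  ... | x ∷ y ∷ z ∷ [] , xyz∈ , iso with ∈-subseqs₃⁻ xs xyz∈
  ... | i , j , k , i<j , j<k , k<l , eq₁ , eq₂ , eq₃ =
    i , j , k , i<j , j<k , k<l , subst₃ R eq₁ eq₂ eq₃ (to (π≈R x y z) iso)

  Occurs⇒contains : ∀ (xs : List (Fin n)) → Occurs R (entry xs) (length xs) → T (any (orderIso π) (subseqs 3 xs))
  Occurs⇒contains xs (i , j , k , i<j , j<k , k<l , r) with ∈-subseqs₃⁺ xs i<j j<k k<l
  ... | x , y , z , xyz∈ , eq₁ , eq₂ , eq₃ =
    any⁺ (orderIso π) (lose xyz∈ (from (π≈R x y z) (subst₃ R (sym eq₁) (sym eq₂) (sym eq₃) r)))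

  avoids⇔¬Occurs : ∀ (τ : Vec (Fin n) n) → T (avoids π τ) ⇔ (¬ Occurs R ⟦ τ ⟧ n)
  avoids⇔¬Occurs τ with contains π τ in eq
  ... | true  = mk⇔ (λ ()) λ ¬occ →
    ¬occ (subst (Occurs R ⟦ τ ⟧) (length-toList τ) (contains⇒Occurs (toList τ) (from T-≡ eq)))
  ... | false = mk⇔ (λ _ occ → subst T eq
    (Occurs⇒contains (toList τ) (subst (Occurs R ⟦ τ ⟧) (sym (length-toList τ)) occ))) _

⟦⟧-lookup : ∀ {n m} (v : Vec (Fin n) m) (i : Fin m) → ⟦ v ⟧ (toℕ i) ≡ toℕ (lookup v i)
⟦⟧-lookup (x ∷ v) Fin.zero    = refl
⟦⟧-lookup (x ∷ v) (Fin.suc i) = ⟦⟧-lookup v i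

⟦⟧-fromℕ< : ∀ {n m} (v : Vec (Fin n) m) {t} (t<m : t < m) → ⟦ v ⟧ t ≡ toℕ (lookup v (fromℕ< t<m))
⟦⟧-fromℕ< v t<m = trans (cong ⟦ v ⟧ (sym (toℕ-fromℕ< t<m))) (⟦⟧-lookup v (fromℕ< t<m))

⟦⟧-< : ∀ {n m} (v : Vec (Fin n) m) {t} → t < m → ⟦ v ⟧ t < n
⟦⟧-< v t<m rewrite ⟦⟧-fromℕ< v t<m = toℕ<n _

⟦⟧-ext : ∀ {n m} (v w : Vec (Fin n) m) → (∀ {t} → t < m → ⟦ v ⟧ t ≡ ⟦ w ⟧ t) → v ≡ w
⟦⟧-ext []      []      _  = refl
⟦⟧-ext (x ∷ v) (y ∷ w) eq =
  cong₂ _∷_ (toℕ-injective (eq (s≤s z≤n))) (⟦⟧-ext v w (λ t<m → eq (s≤s t<m)))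

injective?⇔ : ∀ {n} (v : Vec (Fin n) n) → T (injective? v) ⇔ (∀ i j → lookup v i ≡ lookup v j → i ≡ j)
injective?⇔ {n} v = mk⇔ injective pairwise
  where
  injective : T (injective? v) → ∀ i j → lookup v i ≡ lookup v j → i ≡ j
  injective inj? i j vi≡vj
    with i Fin.≟ j | lookup v i Fin.≟ lookup v j
       | All.lookup (all⁺ _ _ (All.lookup (all⁺ _ _ inj?) (∈-allFin i))) (∈-allFin j)
  ... | yes i≡j | _        | _  = i≡j
  ... | no _    | yes _    | ()
  ... | no _    | no vi≢vj | _  = contradiction vi≡vj vi≢vj

  pairwise : (∀ i j → lookup v i ≡ lookup v j → i ≡ j) → T (injective? v)
  pairwise inj =
    all⁻ _ {allFin n} (All.tabulate λ {i} _ → all⁻ _ {allFin n} (All.tabulate λ {j} _ → distinct i j))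
    where
    distinct : ∀ i j → T (⌊ i Fin.≟ j ⌋ ∨ not ⌊ lookup v i Fin.≟ lookup v j ⌋)
    distinct i j with i Fin.≟ j | lookup v i Fin.≟ lookup v j
    ... | yes _ | _        = _
    ... | no _  | no _     = _
    ... | no i≢j | yes vi≡vj = i≢j (inj i j vi≡vj)

injective?⇔InjectiveOn : ∀ {n} (v : Vec (Fin n) n) → T (injective? v) ⇔ InjectiveOn ⟦ v ⟧ n
injective?⇔InjectiveOn v = mk⇔ onℕ onFin
  where
  onℕ : T (injective? v) → InjectiveOn ⟦ v ⟧ _
  onℕ inj? {s} {t} s<n t<n eq = begin
    s                  ≡⟨ toℕ-fromℕ< s<n ⟨
    toℕ (fromℕ< s<n)   ≡⟨ cong toℕ (to (injective?⇔ v) inj? _ _ (toℕ-injective vs≡vt)) ⟩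
    toℕ (fromℕ< t<n)   ≡⟨ toℕ-fromℕ< t<n ⟩
    t                  ∎
    where
    open ≡-Reasoning
    vs≡vt : toℕ (lookup v (fromℕ< s<n)) ≡ toℕ (lookup v (fromℕ< t<n))
    vs≡vt = trans (sym (⟦⟧-fromℕ< v s<n)) (trans eq (⟦⟧-fromℕ< v t<n))

  onFin : InjectiveOn ⟦ v ⟧ _ → T (injective? v)
  onFin inj = from (injective?⇔ v) λ i j vi≡vj → toℕ-injective (inj (toℕ<n i) (toℕ<n j)
    (trans (⟦⟧-lookup v i) (trans (cong toℕ vi≡vj) (sym (⟦⟧-lookup v j)))))

concatMap-map≡cartesianProductWith : ∀ {A B C : Set} (f : A → B → C) xs ys →
  concatMap (λ x → map (f x) ys) xs ≡ cartesianProductWith f xs ys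
concatMap-map≡cartesianProductWith f []       ys = refl
concatMap-map≡cartesianProductWith f (x ∷ xs) ys =
  cong (map (f x) ys ++_) (concatMap-map≡cartesianProductWith f xs ys)

∈-allVecs : ∀ {m n} (v : Vec (Fin m) n) → v ∈ allVecs m n
∈-allVecs []               = here refl
∈-allVecs {m} {suc n} (x ∷ v) =
  subst (x ∷ v ∈_) (sym (concatMap-map≡cartesianProductWith _∷_ (allFin m) (allVecs m n)))
    (∈-cartesianProductWith⁺ _∷_ (∈-allFin x) (∈-allVecs v))

allVecs-unique : ∀ m n → Unique (allVecs m n)
allVecs-unique m zero    = All.[] AllPairs.∷ AllPairs.[]
allVecs-unique m (suc n) =
  subst Unique (sym (concatMap-map≡cartesianProductWith _∷_ (allFin m) (allVecs m n)))
    (Unique.cartesianProductWith⁺ _∷_ ∷-injective (Unique.allFin⁺ m) (allVecs-unique m n))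

∈-perms⇔ : ∀ {n} {v : Vec (Fin n) n} → v ∈ perms n ⇔ T (injective? v)
∈-perms⇔ {n} {v} = mk⇔
  (from T-≡ ∘′ proj₂ ∘′ ∈-filter⁻ _ {xs = allVecs n n})
  (∈-filter⁺ _ (∈-allVecs v) ∘′ to T-≡)

perms-unique : ∀ n → Unique (perms n)
perms-unique n = Unique.filter⁺ _ (allVecs-unique n n)

pairs-avoiding : List Pattern → ∀ {n} →
  List (Vec (Fin n) n × Vec (Fin n) n) → List (Vec (Fin n) n × Vec (Fin n) n)
pairs-avoiding ps = filter (λ s → avoidsAll ps s Bool.≟ true)

S2≡ : ∀ n ps → S2 n ps ≡ pairs-avoiding ps (cartesianProduct (perms n) (perms n))
S2≡ n ps = cong (pairs-avoiding ps) (concatMap-map≡cartesianProductWith _,_ (perms n) (perms n))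

∈-S2⇔ : ∀ {n ps} {σ σ′ : Vec (Fin n) n} →
  (σ , σ′) ∈ S2 n ps ⇔ (T (injective? σ) × T (injective? σ′) × T (avoidsAll ps (σ , σ′)))
∈-S2⇔ {n} {ps} {σ} {σ′} = mk⇔
  (members ∘′ subst ((σ , σ′) ∈_) (S2≡ n ps))
  (subst ((σ , σ′) ∈_) (sym (S2≡ n ps)) ∘′ permutations)
  where
  members : (σ , σ′) ∈ pairs-avoiding ps (cartesianProduct (perms n) (perms n)) →
    T (injective? σ) × T (injective? σ′) × T (avoidsAll ps (σ , σ′))
  members σσ′∈ with ∈-filter⁻ _ {xs = cartesianProduct (perms n) (perms n)} σσ′∈
  ... | σσ′∈× , avoid with ∈-cartesianProduct⁻ (perms n) (perms n) σσ′∈×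
  ... | σ∈ , σ′∈ = to ∈-perms⇔ σ∈ , to ∈-perms⇔ σ′∈ , from T-≡ avoid

  permutations : T (injective? σ) × T (injective? σ′) × T (avoidsAll ps (σ , σ′)) →
    (σ , σ′) ∈ pairs-avoiding ps (cartesianProduct (perms n) (perms n))
  permutations (σ-inj , σ′-inj , avoid) =
    ∈-filter⁺ _ (∈-cartesianProduct⁺ (from ∈-perms⇔ σ-inj) (from ∈-perms⇔ σ′-inj)) (to T-≡ avoid)

S2-unique : ∀ n ps → Unique (S2 n ps)
S2-unique n ps = subst Unique (sym (S2≡ n ps))
  (Unique.filter⁺ _ (Unique.cartesianProduct⁺ (perms-unique n) (perms-unique n)))

-- `inverse` searches with a function local to its definition, which cannot be named.
-- Unification recovers it: the metavariables `search₀` and `searchₛ` are solved by the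
-- `refl` proofs below (one for the target zero, one for targets suc y), and applied to
-- `false` they continue the search on an arbitrary list.
module Inverse {n : ℕ} (σ : Vec (Fin (suc n)) (suc n)) where

  private
    tabulated-tail : ∀ {m} {A : Set} {a : A} {h : Fin m → A} (v : Vec A (suc m)) →
      v ≡ a ∷ Vec.tabulate h → Fin m → A
    tabulated-tail {h = h} _ _ = h

    mutual
      search₀ : List (Fin (suc n)) → Bool → Fin (suc n)
      search₀ = _

      search₀-solved : search₀ (List.tabulate Fin.suc) ⌊ lookup σ Fin.zero Fin.≟ Fin.zero ⌋ ≡
                       lookup (inverse σ) Fin.zero
      search₀-solved with List.tabulate {n = n} Fin.suc | ⌊ lookup σ Fin.zero Fin.≟ Fin.zero ⌋
      ... | _ | _ = refl

    mutual
      searchₛ : Fin n → List (Fin (suc n)) → Bool → Fin (suc n)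
      searchₛ = _

      searchₛ-solved : ∀ y → searchₛ y (List.tabulate Fin.suc) ⌊ lookup σ Fin.zero Fin.≟ Fin.suc y ⌋ ≡
                       tabulated-tail (inverse σ) refl y
      searchₛ-solved y with List.tabulate {n = n} Fin.suc | ⌊ lookup σ Fin.zero Fin.≟ Fin.suc y ⌋
      ... | _ | _ = refl

  search : Fin (suc n) → List (Fin (suc n)) → Fin (suc n)
  search Fin.zero    xs = search₀ xs false
  search (Fin.suc y) xs = searchₛ y xs false

  lookup-inverse≡search : ∀ y → lookup (inverse σ) y ≡ search y (allFin (suc n))
  lookup-inverse≡search Fin.zero    = refl
  lookup-inverse≡search (Fin.suc y) = lookup∘tabulate (tabulated-tail (inverse σ) refl) y

  search-hit : ∀ y x xs → lookup σ x ≡ y → search y (x ∷ xs) ≡ x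
  search-hit Fin.zero x xs σx≡y with lookup σ x Fin.≟ Fin.zero
  ... | yes _ = refl
  ... | no σx≢y = contradiction σx≡y σx≢y
  search-hit (Fin.suc y) x xs σx≡y with lookup σ x Fin.≟ Fin.suc y
  ... | yes _ = refl
  ... | no σx≢y = contradiction σx≡y σx≢y

  search-miss : ∀ y x xs → lookup σ x ≢ y → search y (x ∷ xs) ≡ search y xs
  search-miss Fin.zero x xs σx≢y with lookup σ x Fin.≟ Fin.zero
  ... | yes σx≡y = contradiction σx≡y σx≢y
  ... | no _ = refl
  search-miss (Fin.suc y) x xs σx≢y with lookup σ x Fin.≟ Fin.suc y
  ... | yes σx≡y = contradiction σx≡y σx≢y
  ... | no _ = refl

  search-finds : ∀ y {j} xs → j ∈ xs → lookup σ j ≡ y → lookup σ (search y xs) ≡ y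
  search-finds y (x ∷ xs) j∈ σj≡y with lookup σ x Fin.≟ y
  ... | yes σx≡y = subst (λ z → lookup σ z ≡ y) (sym (search-hit y x xs σx≡y)) σx≡y
  search-finds y (x ∷ xs) (here refl)  σj≡y | no σx≢y = contradiction σj≡y σx≢y
  search-finds y (x ∷ xs) (there j∈) σj≡y | no σx≢y =
    subst (λ z → lookup σ z ≡ y) (sym (search-miss y x xs σx≢y)) (search-finds y xs j∈ σj≡y)

  lookup-inverse : (∀ i j → lookup σ i ≡ lookup σ j → i ≡ j) →
    ∀ {y j} → lookup σ j ≡ y → lookup (inverse σ) y ≡ j
  lookup-inverse σ-inj {y} {j} σj≡y rewrite lookup-inverse≡search y =
    σ-inj _ _ (trans (search-finds y (allFin (suc n)) (∈-allFin j) σj≡y) (sym σj≡y))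

lookup-compose-inverse : ∀ {n} (σ σ′ : Vec (Fin (suc n)) (suc n)) →
  (∀ i j → lookup σ i ≡ lookup σ j → i ≡ j) →
  ∀ {i j} → lookup σ j ≡ i → lookup (compose σ′ (inverse σ)) i ≡ lookup σ′ j
lookup-compose-inverse σ σ′ σ-injective {i} σj≡i =
  trans (lookup∘tabulate (λ i → lookup σ′ (lookup (inverse σ) i)) i)
        (cong (lookup σ′) (Inverse.lookup-inverse σ σ-injective σj≡i))

T-∧³ : ∀ {x y z} → T (x ∧ y ∧ z) ⇔ (T x × T y × T z)
T-∧³ {x} = mk⇔
  (λ xyz → let (tx , tyz) = to (T-∧ {x}) xyz in tx , to T-∧ tyz)
  (λ (tx , ty , tz) → from T-∧ (tx , from T-∧ (ty , tz)))

Avoids₃⇔avoids : ∀ {n} (σ : Vec (Fin n) n) →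
  (T (avoids (Pattern.word p213) σ) × T (avoids (Pattern.word p231) σ) × T (avoids (Pattern.word p321) σ)) ⇔
  Avoids₃ ⟦ σ ⟧ n
Avoids₃⇔avoids {n} σ = mk⇔
  (λ (a₁ , a₂ , a₃) → to A213 a₁ , to A231 a₂ , to A321 a₃)
  (λ (a₁ , a₂ , a₃) → from A213 a₁ , from A231 a₂ , from A321 a₃)
  where
  A213 : T (avoids (Pattern.word p213) σ) ⇔ (¬ Occurs Is213 ⟦ σ ⟧ n)
  A213 = avoids⇔¬Occurs {π = Pattern.word p213} {R = Is213} characterises213 σ
  A231 : T (avoids (Pattern.word p231) σ) ⇔ (¬ Occurs Is231 ⟦ σ ⟧ n)
  A231 = avoids⇔¬Occurs {π = Pattern.word p231} {R = Is231} characterises231 σ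
  A321 : T (avoids (Pattern.word p321) σ) ⇔ (¬ Occurs Is321 ⟦ σ ⟧ n)
  A321 = avoids⇔¬Occurs {π = Pattern.word p321} {R = Is321} characterises321 σ

patterns : List Pattern
patterns = p213 ∷ p231 ∷ p321 ∷ []

avoidsAll⇔Avoids₃ : ∀ {n} (σ σ′ : Vec (Fin n) n) → T (avoidsAll patterns (σ , σ′)) ⇔
  (Avoids₃ ⟦ σ ⟧ n × Avoids₃ ⟦ σ′ ⟧ n × Avoids₃ ⟦ compose σ′ (inverse σ) ⟧ n)
avoidsAll⇔Avoids₃ {n} σ σ′ = mk⇔ split join
  where
  τ : Vec (Fin n) n
  τ = compose σ′ (inverse σ)

  AvoidedBy : Pattern → Set
  AvoidedBy p = T (avoids (Pattern.word p) σ) × T (avoids (Pattern.word p) σ′) × T (avoids (Pattern.word p) τ)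

  avoids3⇔ : ∀ p → T (avoids3 p (σ , σ′)) ⇔ AvoidedBy p
  avoids3⇔ p = T-∧³

  split : T (avoidsAll patterns (σ , σ′)) → Avoids₃ ⟦ σ ⟧ n × Avoids₃ ⟦ σ′ ⟧ n × Avoids₃ ⟦ τ ⟧ n
  split all-avoid with all⁺ (λ p → avoids3 p (σ , σ′)) patterns all-avoid
  ... | a₁ All.∷ a₂ All.∷ a₃ All.∷ All.[] =
    let σ₁ , σ′₁ , τ₁ = to (avoids3⇔ p213) a₁
        σ₂ , σ′₂ , τ₂ = to (avoids3⇔ p231) a₂
        σ₃ , σ′₃ , τ₃ = to (avoids3⇔ p321) a₃
    in to (Avoids₃⇔avoids σ) (σ₁ , σ₂ , σ₃) , to (Avoids₃⇔avoids σ′) (σ′₁ , σ′₂ , σ′₃) ,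
       to (Avoids₃⇔avoids τ) (τ₁ , τ₂ , τ₃)

  join : Avoids₃ ⟦ σ ⟧ n × Avoids₃ ⟦ σ′ ⟧ n × Avoids₃ ⟦ τ ⟧ n → T (avoidsAll patterns (σ , σ′))
  join (σ-avoids , σ′-avoids , τ-avoids) =
    let σ₁ , σ₂ , σ₃ = from (Avoids₃⇔avoids σ) σ-avoids
        σ′₁ , σ′₂ , σ′₃ = from (Avoids₃⇔avoids σ′) σ′-avoids
        τ₁ , τ₂ , τ₃ = from (Avoids₃⇔avoids τ) τ-avoids
    in all⁻ (λ p → avoids3 p (σ , σ′)) {patterns}
         (from (avoids3⇔ p213) (σ₁ , σ′₁ , τ₁) All.∷ from (avoids3⇔ p231) (σ₂ , σ′₂ , τ₂) All.∷
          from (avoids3⇔ p321) (σ₃ , σ′₃ , τ₃) All.∷ All.[])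

maxAtᶠ : ∀ n → ℕ → Fin (suc n) → Fin (suc n)
maxAtᶠ n m i = fromℕ< (maxAt-bounded {n} {m} (toℕ<n i))

maxAtᵛ : ∀ n → ℕ → Vec (Fin (suc n)) (suc n)
maxAtᵛ n m = Vec.tabulate (maxAtᶠ n m)

module _ {n m : ℕ} where

  lookup-maxAtᵛ : ∀ j → toℕ (lookup (maxAtᵛ n m) j) ≡ maxAt n m (toℕ j)
  lookup-maxAtᵛ j =
    trans (cong toℕ (lookup∘tabulate (maxAtᶠ n m) j)) (toℕ-fromℕ< (maxAt-bounded (toℕ<n j)))

  ⟦maxAtᵛ⟧ : ∀ {t} → t < suc n → ⟦ maxAtᵛ n m ⟧ t ≡ maxAt n m t
  ⟦maxAtᵛ⟧ {t} t<1+n = begin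
    ⟦ maxAtᵛ n m ⟧ t                           ≡⟨ ⟦⟧-fromℕ< (maxAtᵛ n m) t<1+n ⟩
    toℕ (lookup (maxAtᵛ n m) (fromℕ< t<1+n))  ≡⟨ lookup-maxAtᵛ (fromℕ< t<1+n) ⟩
    maxAt n m (toℕ (fromℕ< t<1+n))            ≡⟨ cong (maxAt n m) (toℕ-fromℕ< t<1+n) ⟩
    maxAt n m t                                ∎
    where open ≡-Reasoning

  module _ (m<1+n : m < suc n) where

    maxAtᵛ-injective? : T (injective? (maxAtᵛ n m))
    maxAtᵛ-injective? = from (injective?⇔InjectiveOn (maxAtᵛ n m))
      (InjectiveOn-cong (λ t<1+n → sym (⟦maxAtᵛ⟧ t<1+n))
        (increasingExcept⇒InjectiveOn maxAt-increasingExcept (maxAt-maximumAt m<1+n)))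

    maxAtᵛ-Avoids₃ : Avoids₃ ⟦ maxAtᵛ n m ⟧ (suc n)
    maxAtᵛ-Avoids₃ = Avoids₃-cong (λ t<1+n → sym (⟦maxAtᵛ⟧ t<1+n))
      (increasingExcept⇒Avoids₃ maxAt-increasingExcept (maxAt-maximumAt m<1+n))

maxAtᵛ-injective : ∀ {n a b} → a < suc n → b < suc n → maxAtᵛ n a ≡ maxAtᵛ n b → a ≡ b
maxAtᵛ-injective {n} {a} {b} a<1+n b<1+n Ra≡Rb =
  increasingExcept⇒InjectiveOn maxAt-increasingExcept (maxAt-maximumAt b<1+n) a<1+n b<1+n (begin
    maxAt n b a            ≡⟨ ⟦maxAtᵛ⟧ a<1+n ⟨
    ⟦ maxAtᵛ n b ⟧ a       ≡⟨ cong (λ σ → ⟦ σ ⟧ a) Ra≡Rb ⟨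
    ⟦ maxAtᵛ n a ⟧ a       ≡⟨ ⟦maxAtᵛ⟧ a<1+n ⟩
    maxAt n a a            ≡⟨ maxAt-≡ {n} {a} ⟩
    n                      ≡⟨ maxAt-≡ {n} {b} ⟨
    maxAt n b b            ∎)
  where open ≡-Reasoning

Avoids₃⇒≡maxAtᵛ : ∀ {n} (σ : Vec (Fin (suc n)) (suc n)) → T (injective? σ) → Avoids₃ ⟦ σ ⟧ (suc n) →
  ∃[ m ] m < suc n × σ ≡ maxAtᵛ n m
Avoids₃⇒≡maxAtᵛ {n} σ σ-injective avoid =
  let m , m<1+n , σ≗maxAt =
        Avoids₃⇒maxAt {n} {⟦ σ ⟧} (⟦⟧-< σ) (to (injective?⇔InjectiveOn σ) σ-injective) avoid
  in m , m<1+n , ⟦⟧-ext σ (maxAtᵛ n m) λ t<1+n → trans (σ≗maxAt t<1+n) (sym (⟦maxAtᵛ⟧ t<1+n))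

⟦maxAtᵛ∘maxAtᵛ⁻¹⟧ : ∀ {n a b} → a < suc n → ∀ {t} → t < suc n →
  ⟦ compose (maxAtᵛ n b) (inverse (maxAtᵛ n a)) ⟧ t ≡ maxAt n b (maxAt⁻¹ n a t)
⟦maxAtᵛ∘maxAtᵛ⁻¹⟧ {n} {a} {b} a<1+n {t} t<1+n = begin
  ⟦ τ ⟧ t                                   ≡⟨ ⟦⟧-fromℕ< τ t<1+n ⟩
  toℕ (lookup τ (fromℕ< t<1+n))             ≡⟨ cong toℕ τ[t]≡Rb[p] ⟩
  toℕ (lookup (maxAtᵛ n b) position)        ≡⟨ lookup-maxAtᵛ position ⟩
  maxAt n b (toℕ position)                  ≡⟨ cong (maxAt n b) (toℕ-fromℕ< position<1+n) ⟩
  maxAt n b (maxAt⁻¹ n a t)                 ∎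
  where
  open ≡-Reasoning
  τ : Vec (Fin (suc n)) (suc n)
  τ = compose (maxAtᵛ n b) (inverse (maxAtᵛ n a))
  position<1+n : maxAt⁻¹ n a t < suc n
  position<1+n = maxAt⁻¹-bounded a<1+n t<1+n
  position : Fin (suc n)
  position = fromℕ< position<1+n
  Ra-injective : ∀ i j → lookup (maxAtᵛ n a) i ≡ lookup (maxAtᵛ n a) j → i ≡ j
  Ra-injective = to (injective?⇔ (maxAtᵛ n a)) (maxAtᵛ-injective? a<1+n)

  Ra[p]≡t : lookup (maxAtᵛ n a) position ≡ fromℕ< t<1+n
  Ra[p]≡t = toℕ-injective (begin
    toℕ (lookup (maxAtᵛ n a) position)  ≡⟨ lookup-maxAtᵛ position ⟩
    maxAt n a (toℕ position)            ≡⟨ cong (maxAt n a) (toℕ-fromℕ< position<1+n) ⟩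
    maxAt n a (maxAt⁻¹ n a t)           ≡⟨ maxAt-maxAt⁻¹ a<1+n t<1+n ⟩
    t                                   ≡⟨ toℕ-fromℕ< t<1+n ⟨
    toℕ (fromℕ< t<1+n)                  ∎)

  τ[t]≡Rb[p] : lookup τ (fromℕ< t<1+n) ≡ lookup (maxAtᵛ n b) position
  τ[t]≡Rb[p] = lookup-compose-inverse (maxAtᵛ n a) (maxAtᵛ n b) Ra-injective {j = position} Ra[p]≡t

Avoids₃⇒compatible : ∀ {n a b} → a < suc n → b < suc n →
  Avoids₃ ⟦ compose (maxAtᵛ n b) (inverse (maxAtᵛ n a)) ⟧ (suc n) → Compatible n a b
Avoids₃⇒compatible {n} {a} {b} a<1+n b<1+n avoid = decidable-stable (Compatible? n a b) λ incompatible →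
  ¬compatible⇒¬Avoids₃ a<1+n b<1+n incompatible (Avoids₃-cong (⟦maxAtᵛ∘maxAtᵛ⁻¹⟧ a<1+n) avoid)

∈-S2⇒compatible : ∀ {n} {σ σ′ : Vec (Fin (suc n)) (suc n)} → (σ , σ′) ∈ S2 (suc n) patterns →
  ∃[ a ] ∃[ b ] a < suc n × b < suc n × Compatible n a b × σ ≡ maxAtᵛ n a × σ′ ≡ maxAtᵛ n b
∈-S2⇒compatible {n} {σ} {σ′} σσ′∈ =
  let σ-injective , σ′-injective , all-avoid = to (∈-S2⇔ {suc n} {patterns} {σ} {σ′}) σσ′∈
      σ-avoids , σ′-avoids , τ-avoids = to (avoidsAll⇔Avoids₃ σ σ′) all-avoid
      a , a<1+n , σ≡Ra = Avoids₃⇒≡maxAtᵛ σ σ-injective σ-avoids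
      b , b<1+n , σ′≡Rb = Avoids₃⇒≡maxAtᵛ σ′ σ′-injective σ′-avoids
      composite-avoids =
        subst₂ (λ ρ ρ′ → Avoids₃ ⟦ compose ρ′ (inverse ρ) ⟧ (suc n)) σ≡Ra σ′≡Rb τ-avoids
  in a , b , a<1+n , b<1+n , Avoids₃⇒compatible a<1+n b<1+n composite-avoids , σ≡Ra , σ′≡Rb

compatible⇒∈S2 : ∀ {n a b} → a < suc n → b < suc n → Compatible n a b →
  (maxAtᵛ n a , maxAtᵛ n b) ∈ S2 (suc n) patterns
compatible⇒∈S2 {n} {a} {b} a<1+n b<1+n compatible =
  let c , c<1+n , composite≗maxAt = compatible⇒maxAt a<1+n b<1+n compatible
      composite≗maxAtᵛ : ∀ {t} → t < suc n →
        ⟦ maxAtᵛ n c ⟧ t ≡ ⟦ compose (maxAtᵛ n b) (inverse (maxAtᵛ n a)) ⟧ t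
      composite≗maxAtᵛ t<1+n = trans (trans (⟦maxAtᵛ⟧ t<1+n) (sym (composite≗maxAt t<1+n)))
                                     (sym (⟦maxAtᵛ∘maxAtᵛ⁻¹⟧ a<1+n t<1+n))
  in from (∈-S2⇔ {suc n} {patterns} {maxAtᵛ n a} {maxAtᵛ n b})
    (maxAtᵛ-injective? a<1+n , maxAtᵛ-injective? b<1+n ,
     from (avoidsAll⇔Avoids₃ (maxAtᵛ n a) (maxAtᵛ n b))
       (maxAtᵛ-Avoids₃ a<1+n , maxAtᵛ-Avoids₃ b<1+n , Avoids₃-cong composite≗maxAtᵛ (maxAtᵛ-Avoids₃ c<1+n)))

module _ (k : ℕ) where

  private
    n N : ℕ
    n = suc k
    N = suc n

    R : ℕ → Vec (Fin N) N
    R = maxAtᵛ n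

    identity-first diagonal : ℕ → Vec (Fin N) N × Vec (Fin N) N
    identity-first b = R n , R b
    diagonal a = R a , R a

    identity-firsts diagonals last : List (Vec (Fin N) N × Vec (Fin N) N)
    identity-firsts = applyUpTo identity-first N
    diagonals = applyUpTo diagonal n
    last = (R k , R n) ∷ []

  compatiblePairs : List (Vec (Fin N) N × Vec (Fin N) N)
  compatiblePairs = identity-firsts ++ diagonals ++ last

  ∈-compatiblePairs⁺ : ∀ {a b} → a < N → b < N → Compatible n a b → (R a , R b) ∈ compatiblePairs
  ∈-compatiblePairs⁺ _ b<N (inj₁ refl) = ∈-++⁺ˡ {xs = identity-firsts} (∈-applyUpTo⁺ identity-first b<N)
  ∈-compatiblePairs⁺ a<N _ (inj₂ (inj₁ refl)) with m≤n⇒m<n∨m≡n (≤-pred a<N)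
  ... | inj₁ a<n  = ∈-++⁺ʳ identity-firsts (∈-++⁺ˡ {xs = diagonals} (∈-applyUpTo⁺ diagonal a<n))
  ... | inj₂ refl = ∈-++⁺ˡ {xs = identity-firsts} (∈-applyUpTo⁺ identity-first a<N)
  ∈-compatiblePairs⁺ _ _ (inj₂ (inj₂ (refl , refl))) =
    ∈-++⁺ʳ identity-firsts (∈-++⁺ʳ diagonals (here refl))

  ∈-compatiblePairs⁻ : ∀ {p} → p ∈ compatiblePairs →
    ∃[ a ] ∃[ b ] a < N × b < N × Compatible n a b × p ≡ (R a , R b)
  ∈-compatiblePairs⁻ p∈ with ∈-++⁻ identity-firsts p∈
  ... | inj₁ p∈₁ with ∈-applyUpTo⁻ identity-first p∈₁
  ...   | b , b<N , refl = n , b , n<1+n n , b<N , inj₁ refl , refl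
  ∈-compatiblePairs⁻ p∈ | inj₂ p∈₂ with ∈-++⁻ diagonals p∈₂
  ... | inj₁ p∈₂′ with ∈-applyUpTo⁻ diagonal p∈₂′
  ...   | a , a<n , refl = a , a , m<n⇒m<1+n a<n , m<n⇒m<1+n a<n , inj₂ (inj₁ refl) , refl
  ∈-compatiblePairs⁻ p∈ | inj₂ p∈₂ | inj₂ (here refl) =
    k , n , m<n⇒m<1+n (n<1+n k) , n<1+n n , inj₂ (inj₂ (refl , refl)) , refl

  private
    k<N : k < N
    k<N = m<n⇒m<1+n (n<1+n k)

    n<N : n < N
    n<N = n<1+n n

    R-injective : ∀ {a b} → a < N → b < N → R a ≡ R b → a ≡ b
    R-injective = maxAtᵛ-injective

    ∈-diagonal⁻ : ∀ {a b} → a < N → b < N → (R a , R b) ∈ diagonals → a ≡ b × a < n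
    ∈-diagonal⁻ a<N b<N p∈ with ∈-applyUpTo⁻ diagonal p∈
    ... | c , c<n , p≡
      with R-injective a<N (m<n⇒m<1+n c<n) (cong proj₁ p≡) | R-injective b<N (m<n⇒m<1+n c<n) (cong proj₂ p≡)
    ... | refl | refl = refl , c<n

  compatiblePairs-unique : Unique compatiblePairs
  compatiblePairs-unique = Unique.++⁺ {xs = identity-firsts} {ys = diagonals ++ last}
    (Unique.applyUpTo⁺₁ identity-first N λ i<j j<N eq →
      <⇒≢ i<j (R-injective (<-trans i<j j<N) j<N (cong proj₂ eq)))
    (Unique.++⁺ {xs = diagonals} {ys = last}
      (Unique.applyUpTo⁺₁ diagonal n λ i<j j<n eq →
        <⇒≢ i<j (R-injective (<-trans i<j (m<n⇒m<1+n j<n)) (m<n⇒m<1+n j<n) (cong proj₁ eq)))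
      (All.[] AllPairs.∷ AllPairs.[])
      λ { (p∈ , here refl) → <⇒≢ (n<1+n k) (proj₁ (∈-diagonal⁻ k<N n<N p∈)) })
    λ (p∈₁ , p∈₂₃) → case ∈-applyUpTo⁻ identity-first p∈₁ of λ where
      (b , b<N , refl) → case ∈-++⁻ diagonals p∈₂₃ of λ where
        (inj₁ p∈₂)       → n≮n n (proj₂ (∈-diagonal⁻ n<N b<N p∈₂))
        (inj₂ (here p≡)) → <⇒≢ (n<1+n k) (sym (R-injective n<N k<N (cong proj₁ p≡)))

  length-compatiblePairs : length compatiblePairs ≡ 2 * N
  length-compatiblePairs = begin
    length compatiblePairs
      ≡⟨ length-++ identity-firsts ⟩
    length identity-firsts + length (diagonals ++ last)
      ≡⟨ cong (length identity-firsts +_) (length-++ diagonals) ⟩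
    length identity-firsts + (length diagonals + length last)
      ≡⟨ cong₂ (λ x y → x + (y + 1)) (length-applyUpTo identity-first N) (length-applyUpTo diagonal n) ⟩
    N + (n + 1)
      ≡⟨ cong (N +_) (+-comm n 1) ⟩
    N + N
      ≡⟨ cong (N +_) (+-identityʳ N) ⟨
    2 * N
      ∎
    where open ≡-Reasoning

  S2⊆compatiblePairs : ∀ {p} → p ∈ S2 N patterns → p ∈ compatiblePairs
  S2⊆compatiblePairs {σ , σ′} p∈ =
    let a , b , a<N , b<N , compatible , σ≡Ra , σ′≡Rb = ∈-S2⇒compatible {n} {σ} {σ′} p∈
    in subst₂ (λ ρ ρ′ → (ρ , ρ′) ∈ compatiblePairs) (sym σ≡Ra) (sym σ′≡Rb)
         (∈-compatiblePairs⁺ a<N b<N compatible)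

  compatiblePairs⊆S2 : ∀ {p} → p ∈ compatiblePairs → p ∈ S2 N patterns
  compatiblePairs⊆S2 {p} p∈ =
    let a , b , a<N , b<N , compatible , p≡ = ∈-compatiblePairs⁻ p∈
    in subst (_∈ S2 N patterns) (sym p≡) (compatible⇒∈S2 a<N b<N compatible)

  a-count : a N ≡ 2 * N
  a-count = begin
    a N                    ≡⟨ ↭-length (∼bag⇒↭ (unique∧set⇒bag (S2-unique N patterns) compatiblePairs-unique
                                                               (mk⇔ S2⊆compatiblePairs compatiblePairs⊆S2))) ⟩
    length compatiblePairs ≡⟨ length-compatiblePairs ⟩
    2 * N                  ∎
    where open ≡-Reasoning

theorem4p4 : (a 1 ≡ 1) × (∀ (n : ℕ) → n ≥ 1 → a (suc n) ≡ 2 * suc n)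
theorem4p4 = refl , λ where
  zero    ()
  (suc k) _ → a-count k
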